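{- Let $\langle \Sigma, \circledcirc, \boxdot\rangle$ be a Component Action System and let $a, b, c \in \Sigma$. If $a \circledcirc b$ but not $a \circledcirc c$, then not $(a \boxdot b) \circledcirc c$. Moreover, if not $a \circledcirc c$ and $a \sqsubseteq b$, then not $b \circledcirc c$.
   Context: For a relation $R \subseteq S\times S$, a function $\odot: R \to S$ is a partial operator on $S$ up to $R$ (written infix, $p \odot q$ whenever $pRq$). It is idempotent if $p\odot p = p$ whenever $pRp$; commutative if $p \odot q = q \odot p$ whenever $pRq$ and $qRp$; associative if for all $p,q,r\in S$: ($pRq$ and $(p\odot q)Rr$) holds if and only if ($qRr$ and $pR(q\odot r)$), and either of these implies $(p\odot q)\odot r = p \odot (q\odot r)$. A Component Action System (CAS) is a tuple $\langle \Sigma, \circledcirc, \boxdot\rangle$ where $\Sigma$ is a finite set of actions, $\circledcirc \subseteq \Sigma\times\Sigma$ is a reflexive and symmetric relation (the composability relation), and $\boxdot : \circledcirc \to \Sigma$ is an idempotent, commutative and associative partial operator on $\Sigma$ up to $\circledcirc$. The capture preorder $\sqsubseteq$ on $\Sigma$ is defined by $a \sqsubseteq b$ iff there exists $c\in\Sigma$ with $a \circledcirc c$ and $a \boxdot c = b$. -}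

module Defs where

open import Level using (Level; _⊔_; suc)
open import Data.Nat using (ℕ)
open import Data.Fin using (Fin)
open import Data.Product using (Σ; ∃; _×_; _,_)
open import Relation.Binary.PropositionalEquality using (_≡_)
open import Function.Bundles using (_⇔_)

-- The partial operator ⊡ defined on the relation ⊚ is modelled as a
-- function taking a proof of p ⊚ q.  Its value does not depend on the
-- proof (irrel), since mathematically it is a function on the set ⊚.
record CAS (a r : Level) : Set (Level.suc (a ⊔ r)) where
  field
    Act      : Set a
    size     : ℕ
    enum     : Fin size → Act
    enum-surj : ∀ (x : Act) → ∃ λ i → enum i ≡ x
    _⊚_      : Act → Act → Set r
    _⊡_∣_    : (p q : Act) → p ⊚ q → Act
    irrel    : ∀ {p q} (h h′ : p ⊚ q) → p ⊡ q ∣ h ≡ p ⊡ q ∣ h′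
    ⊚-refl   : ∀ p → p ⊚ p
    ⊚-sym    : ∀ {p q} → p ⊚ q → q ⊚ p
    idem     : ∀ p (h : p ⊚ p) → p ⊡ p ∣ h ≡ p
    comm     : ∀ p q (h : p ⊚ q) (h′ : q ⊚ p) → p ⊡ q ∣ h ≡ q ⊡ p ∣ h′
    assoc-⇒  : ∀ p q r (h : p ⊚ q) → (p ⊡ q ∣ h) ⊚ r →
               Σ (q ⊚ r) λ h′ → p ⊚ (q ⊡ r ∣ h′)
    assoc-⇐  : ∀ p q r (h′ : q ⊚ r) → p ⊚ (q ⊡ r ∣ h′) →
               Σ (p ⊚ q) λ h → (p ⊡ q ∣ h) ⊚ r
    assoc-≡  : ∀ p q r (h : p ⊚ q) (k : (p ⊡ q ∣ h) ⊚ r)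
               (h′ : q ⊚ r) (k′ : p ⊚ (q ⊡ r ∣ h′)) →
               ((p ⊡ q ∣ h) ⊡ r ∣ k) ≡ (p ⊡ (q ⊡ r ∣ h′) ∣ k′)

  _⊑_ : Act → Act → Set (a ⊔ r)
  x ⊑ y = ∃ λ z → Σ (x ⊚ z) λ h → x ⊡ z ∣ h ≡ y

module Submission where

-- The key fact is that composability is inherited by factors: if a ⊡ b
-- is composable with c, then so is each of a and b.  For the right
-- factor b this is exactly the forward direction of associativity
-- (a ⊚ b and (a ⊡ b) ⊚ c give b ⊚ c); for the left factor a we first
-- rewrite a ⊡ b as b ⊡ a by commutativity and apply the same fact.
-- Read contrapositively, an action incompatible with c stays
-- incompatible with c after composing it with anything (part one), and
-- since a ⊑ b means b = a ⊡ z for some z, every action capturing a is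
-- incompatible with c as well (part two).

open import Defs
open import Level using (Level)
open import Data.Product using (_×_; _,_; proj₁)
open import Relation.Nullary using (¬_)
open import Relation.Binary.PropositionalEquality using (_≡_; subst; sym)

module Propagation {ℓa ℓr : Level} (S : CAS ℓa ℓr) where
  open CAS S

  ⊚-respˡ : ∀ {x y c : Act} → x ≡ y → x ⊚ c → y ⊚ c
  ⊚-respˡ {c = c} = subst (λ x → x ⊚ c)

  ⊚-factorʳ : ∀ (a b c : Act) (h : a ⊚ b) → (a ⊡ b ∣ h) ⊚ c → b ⊚ c
  ⊚-factorʳ a b c h k = proj₁ (assoc-⇒ a b c h k)

  ⊚-factorˡ : ∀ (a b c : Act) (h : a ⊚ b) → (a ⊡ b ∣ h) ⊚ c → a ⊚ c
  ⊚-factorˡ a b c h k =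
    ⊚-factorʳ b a c (⊚-sym h) (⊚-respˡ (comm a b h (⊚-sym h)) k)

  composite-incompatible : ∀ (a b c : Act) (h : a ⊚ b) →
                           ¬ (a ⊚ c) → ¬ ((a ⊡ b ∣ h) ⊚ c)
  composite-incompatible a b c h a≁c k = a≁c (⊚-factorˡ a b c h k)

  capture-incompatible : ∀ (a b c : Act) → ¬ (a ⊚ c) → a ⊑ b → ¬ (b ⊚ c)
  capture-incompatible a b c a≁c (z , h , a⊡z≡b) k =
    composite-incompatible a z c h a≁c (⊚-respˡ (sym a⊡z≡b) k)

lemma1 : ∀ {ℓa ℓr : Level} (S : CAS ℓa ℓr) → let open CAS S in
         (∀ (a b c : Act) (h : a ⊚ b) → ¬ (a ⊚ c) → ¬ ((a ⊡ b ∣ h) ⊚ c))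
         × (∀ (a b c : Act) → ¬ (a ⊚ c) → a ⊑ b → ¬ (b ⊚ c))
lemma1 S = composite-incompatible , capture-incompatible
  where open Propagation S
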